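{- Define $\hat\Phi:\mathcal P(\mathcal Q(\mathcal T))\to\mathcal P(\hat{\mathbf E}_{\mathrm{fin}})$ by $\hat\Phi(F):=\{E(\mathcal V):\mathcal V\subseteq F,\ \mathcal V\text{ finite}\}$ and $\hat\Delta:\mathcal P(\hat{\mathbf E}_{\mathrm{fin}})\to\mathcal P(\mathcal Q(\mathcal T))$ by $\hat\Delta(\mathcal F):=\{A\in\mathcal Q(\mathcal T):\overline{\mathbf D}_A\in\mathcal F\}$. Then for all SDFSes $F,F_1,F_2\subseteq\mathcal Q(\mathcal T)$ and all $\mathcal F,\mathcal F_1,\mathcal F_2\subseteq\hat{\mathbf E}_{\mathrm{fin}}$: (i) if $F$ is a finitely coherent SDFS then $\hat\Phi(F)$ is a proper filter on $(\hat{\mathbf E}_{\mathrm{fin}},\subseteq)$; (ii) if $\mathcal F$ is a proper filter on $(\hat{\mathbf E}_{\mathrm{fin}},\subseteq)$ then $\hat\Delta(\mathcal F)$ is a finitely coherent SDFS; (iii) if $F$ is a finitely coherent SDFS then $\hat\Delta(\hat\Phi(F))=F$; (iv) if $\mathcal F$ is a proper filter on $(\hat{\mathbf E}_{\mathrm{fin}},\subseteq)$ then $\hat\Phi(\hat\Delta(\mathcal F))=\mathcal F$; (v) if $F_1\subseteq F_2$ then $\hat\Phi(F_1)\subseteq\hat\Phi(F_2)$; (vi) if $\mathcal F_1\subseteq\mathcal F_2$ then $\hat\Delta(\mathcal F_1)\subseteq\hat\Delta(\mathcal F_2)$; (vii) $\hat\Phi(\{A\in\mathcal Q(\mathcal T):A\cap\mathcal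 T_+\neq\emptyset\})=\{\overline{\mathbf D}\}$ and $\hat\Phi(\mathcal Q(\mathcal T))=\hat{\mathbf E}_{\mathrm{fin}}$; (viii) $\hat\Delta(\{\overline{\mathbf D}\})=\{A\in\mathcal Q(\mathcal T):A\cap\mathcal T_+\neq\emptyset\}$ and $\hat\Delta(\hat{\mathbf E}_{\mathrm{fin}})=\mathcal Q(\mathcal T)$. Hence $\hat\Phi$ is an order isomorphism between $(\mathbf F_{\mathrm{fin}},\subseteq)$, the set of all finitely coherent SDFSes together with $\mathcal Q(\mathcal T)$, and the set $(\mathbf F(\hat{\mathbf E}_{\mathrm{fin}}),\subseteq)$ of all filters on $\hat{\mathbf E}_{\mathrm{fin}}$, with inverse $\hat\Delta$. Moreover, (ix) if a proper filter $\mathcal F$ and a finitely coherent SDFS $F$ satisfy $\mathcal F=\hat\Phi(F)$ and $F=\hat\Delta(\mathcal F)$, then $\mathcal F$ is a prime filter on $(\hat{\mathbf E}_{\mathrm{fin}},\subseteq)$ if and only if $F$ is complete, i.e. for all finite $A_1,A_2\subseteq\mathcal T$, $A_1\cup A_2\in F$ implies $A_1\in F$ or $A_2\in F$.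
   Context: Let $\mathcal T$ be a non-empty set (of "things"), $\mathrm{cl}:\mathcal P(\mathcal T)\to\mathcal P(\mathcal T)$ a closure operator (extensive, monotone, idempotent), $\mathcal T_-\subseteq\mathcal T$ a set of forbidden things, $\mathcal T_+:=\mathrm{cl}(\emptyset)$, with standing assumption $\mathcal T_+\cap\mathcal T_-=\emptyset$. A coherent SDT is a $D\subseteq\mathcal T$ with $\mathrm{cl}(D)=D$ and $D\cap\mathcal T_-=\emptyset$; $\overline{\mathbf D}$ is the set of all coherent SDTs. $\mathcal Q(\mathcal T)$ is the set of finite subsets of $\mathcal T$ (including $\emptyset$). For $\mathcal V\subseteq\mathcal Q(\mathcal T)$, $\Sigma_{\mathcal V}$ is the set of maps $\sigma:\mathcal V\to\mathcal T$ with $\sigma(A)\in A$ for all $A\in\mathcal V$, and $\sigma(\mathcal V):=\{\sigma(A):A\in\mathcal V\}$. An SDFS is any $F\subseteq\mathcal Q(\mathcal T)$. It is finitely coherent if (F1) $\emptyset\notin F$; (F2) if $A_1\in F$ and $A_1\subseteq A_2\in\mathcal Q(\mathcal T)$ then $A_2\in F$; (F3) if $A\in F$ then $A\setminus\mathcal T_-\in F$; (F4) $\{t\}\in F$ for all $t\in\mathcal T_+$; (F5) for every non-empty finite $\mathcal V\subseteq F$ and every family $(t_\sigma)_{\sigma\in\Sigma_{\mathcal V}}$ with $t_\sigma\in\mathrm{cl}(\sigma(\mathcal V))$, $\{t_\sigma:\sigma\in\Sigma_{\mathcal V}\}\in F$. For $S\subseteq\mathcal T$ let $\overline{\mathbf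 D}_S:=\{D\in\overline{\mathbf D}:S\cap D\neq\emptyset\}$, for $\mathcal V\subseteq\mathcal P(\mathcal T)$ let $E(\mathcal V):=\bigcap_{A\in\mathcal V}\overline{\mathbf D}_A$ (with $E(\emptyset)=\overline{\mathbf D}$), and $\hat{\mathbf E}_{\mathrm{fin}}:=\{E(\mathcal V):\mathcal V\subseteq\mathcal Q(\mathcal T)\text{ finite}\}$, ordered by inclusion (a bounded distributive lattice with union as join, intersection as meet, bottom $\emptyset$, top $\overline{\mathbf D}$). A filter on a bounded lattice $(L,\le)$ is a non-empty $\mathcal F\subseteq L$ with $a\in\mathcal F,a\le b\Rightarrow b\in\mathcal F$ and $a,b\in\mathcal F\Rightarrow a\wedge b\in\mathcal F$; proper if $\mathcal F\ne L$; prime if proper and $a\vee b\in\mathcal F\Rightarrow(a\in\mathcal F$ or $b\in\mathcal F)$. -}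

module Defs where

open import Level using (Level; Lift; Setω)
open import Data.List using (List; []; _∷_; _++_)
open import Data.List.Membership.Propositional using (_∈_)
open import Data.List.Relation.Unary.Any using (Any)
open import Data.List.Relation.Unary.All using (All)
open import Data.Product using (Σ; _×_; _,_)
open import Data.Sum using (_⊎_)
open import Data.Empty using (⊥)
import Data.Unit.Polymorphic as UP
open import Relation.Nullary using (¬_)
open import Relation.Binary.PropositionalEquality using (_≡_; _≢_)

Subset : Set → Set₁
Subset T = T → Set

_⊆_ : {T : Set} → Subset T → Subset T → Set
X ⊆ Y = ∀ t → X t → Y t

_≐_ : {T : Set} → Subset T → Subset T → Set
X ≐ Y = (X ⊆ Y) × (Y ⊆ X)

record IsClosure {T : Set} (cl : Subset T → Subset T) : Set₁ where
  field
    extensive  : ∀ X → X ⊆ cl X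
    monotone   : ∀ X Y → X ⊆ Y → cl X ⊆ cl Y
    idempotent : ∀ X → cl (cl X) ≐ cl X

-- classical logic (the paper's ambient metatheory)
ExcludedMiddle : Setω
ExcludedMiddle = ∀ {ℓ : Level} (P : Set ℓ) → P ⊎ ¬ P

module Setup (T : Set) (cl : Subset T → Subset T) (T₋ : Subset T) where

  T₊ : Subset T
  T₊ = cl (λ _ → ⊥)

  Coherent : Subset T → Set
  Coherent D = (cl D ≐ D) × (∀ t → D t → T₋ t → ⊥)

  -- sets of SDTs (subsets of D̄ are those contained in Coherent)
  SDTSet : Set₁
  SDTSet = Subset T → Set

  _≐E_ : SDTSet → SDTSet → Set₁
  X ≐E Y = ∀ D → (X D → Y D) × (Y D → X D)

  _⊆E_ : SDTSet → SDTSet → Set₁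
  X ⊆E Y = ∀ D → X D → Y D

  _∩E_ : SDTSet → SDTSet → SDTSet
  (X ∩E Y) D = X D × Y D

  _∪E_ : SDTSet → SDTSet → SDTSet
  (X ∪E Y) D = X D ⊎ Y D

  Dbar : SDTSet
  Dbar = Coherent

  DS : List T → SDTSet
  DS A D = Coherent D × Any D A

  -- a finite V ⊆ Q(T) is coded by a list of lists
  Code : Set
  Code = List (List T)

  -- E(V) = ⋂_{A ∈ V} D̄_A, with E(∅) = D̄
  E : Code → SDTSet
  E V D = Coherent D × All (λ A → DS A D) V

  ListEq : List T → List T → Set
  ListEq A B = ∀ t → (t ∈ A → t ∈ B) × (t ∈ B → t ∈ A)

  -- SDFSes (subsets of Q(T)) and subsets of Ê_fin (as predicates on codes)
  SDFS : Set₂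
  SDFS = List T → Set₁

  Family : Set₂
  Family = Code → Set₁

  -- being a well-defined subset of Q(T) resp. of Ê_fin
  RespQ : SDFS → Set₁
  RespQ F = ∀ A B → ListEq A B → F A → F B

  RespE : Family → Set₁
  RespE 𝓕 = ∀ V W → E V ≐E E W → 𝓕 V → 𝓕 W

  _≐Q_ : SDFS → SDFS → Set₁
  F ≐Q G = ∀ A → (F A → G A) × (G A → F A)

  _⊆Q_ : SDFS → SDFS → Set₁
  F ⊆Q G = ∀ A → F A → G A

  _≐F_ : Family → Family → Set₁
  𝓕 ≐F 𝓖 = ∀ W → (𝓕 W → 𝓖 W) × (𝓖 W → 𝓕 W)

  _⊆F_ : Family → Family → Set₁
  𝓕 ⊆F 𝓖 = ∀ W → 𝓕 W → 𝓖 W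

  Φ : SDFS → Family
  Φ F W = Σ Code λ V → All F V × (E V ≐E E W)

  Δ : Family → SDFS
  Δ 𝓕 A = Σ Code λ W → 𝓕 W × (E W ≐E DS A)

  record Filter (𝓕 : Family) : Set₂ where
    field
      nonempty : Σ Code 𝓕
      upward   : ∀ a b → 𝓕 a → E a ⊆E E b → 𝓕 b
      meet     : ∀ a b c → 𝓕 a → 𝓕 b → E c ≐E (E a ∩E E b) → 𝓕 c

  ProperFilter : Family → Set₂
  ProperFilter 𝓕 = Filter 𝓕 × ¬ (∀ a → 𝓕 a)

  PrimeFilter : Family → Set₂
  PrimeFilter 𝓕 = ProperFilter 𝓕
    × (∀ a b c → E c ≐E (E a ∪E E b) → 𝓕 c → 𝓕 a ⊎ 𝓕 b)

  _∈𝒱_ : List T → Code → Set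
  A ∈𝒱 V = Any (ListEq A) V

  -- s : List T → T represents a choice map σ ∈ Σ_𝒱 (σ(A) ∈ A, well defined on 𝒱)
  Choice : Code → (List T → T) → Set
  Choice V s = (∀ A → A ∈𝒱 V → s A ∈ A)
             × (∀ A A′ → A ∈𝒱 V → ListEq A A′ → s A ≡ s A′)

  -- two representatives denote the same σ
  Agree : Code → (List T → T) → (List T → T) → Set
  Agree V s s′ = ∀ A → A ∈𝒱 V → s A ≡ s′ A

  Img : Code → (List T → T) → Subset T
  Img V s x = Any (λ A → x ≡ s A) V

  ChoiceFamily : Code → ((List T → T) → T) → Set
  ChoiceFamily V t =
      (∀ s s′ → Choice V s → Choice V s′ → Agree V s s′ → t s ≡ t s′)
    × (∀ s → Choice V s → cl (Img V s) (t s))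

  Enumerates : Code → ((List T → T) → T) → List T → Set
  Enumerates V t B = ∀ x →
      (x ∈ B → Σ (List T → T) λ s → Choice V s × (x ≡ t s))
    × ((Σ (List T → T) λ s → Choice V s × (x ≡ t s)) → x ∈ B)

  record FinCoh (F : SDFS) : Set₁ where
    field
      F1 : ¬ F []
      F2 : ∀ A₁ A₂ → F A₁ → (∀ t → t ∈ A₁ → t ∈ A₂) → F A₂
      F3 : ∀ A B → F A → (∀ t → (t ∈ B → (t ∈ A × ¬ T₋ t)) × ((t ∈ A × ¬ T₋ t) → t ∈ B)) → F B
      F4 : ∀ t → T₊ t → F (t ∷ [])
      F5 : ∀ V → V ≢ [] → All F V → ∀ t → ChoiceFamily V t
             → ∀ B → Enumerates V t B → F B

  Complete : SDFS → Set₁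
  Complete F = ∀ A₁ A₂ → F (A₁ ++ A₂) → F A₁ ⊎ F A₂

  InFfin : SDFS → Set₁
  InFfin F = FinCoh F ⊎ (∀ A → F A)

  MeetsT₊ : SDFS
  MeetsT₊ A = Lift _ (Any T₊ A)

  AllQ : SDFS
  AllQ _ = UP.⊤

  SingletonDbar : Family
  SingletonDbar W = E W ≐E Dbar

  AllE : Family
  AllE _ = UP.⊤

-- Everything rests on an entailment lemma: if F is finitely coherent, V ⊆ F is finite and
-- E(V) ⊆ D̄_B, then B ∈ F.  For each choice σ the closure cl(σ(V)) either meets T₋ or is
-- coherent, and then it lies in E(V) and meets B; so some t_σ ∈ cl(σ(V)) lies in B ∪ T₋.
-- By (F5) the set {t_σ} is in F, and (F2), (F3) turn it into ({t_σ} ∪ B) ∖ T₋ ⊆ B.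
-- Conversely a coherent D ∈ E(V) admits a choice σ with σ(V) ⊆ D, hence cl(σ(V)) ⊆ D, so
-- every (F5) set meets D: this makes Δ̂ of a filter satisfy (F5).  With the entailment lemma
-- Φ̂(F) is upward closed, Δ̂(Φ̂(F)) = F, and completeness of F splits E(V) ⊆ E(a) ∪ E(b)
-- into a ⊆ F or b ⊆ F, which is primality.
module Submission where

open import Defs
open import Level using (lift; lower)
open import Function using (_∘_; id)
open import Data.List using (List; []; _∷_; _++_; [_]; map; filter; cartesianProductWith)
open import Data.List.Properties using (map-cong-local)
open import Data.List.Membership.Propositional using (_∈_; lose; find)
open import Data.List.Membership.Propositional.Properties
  using (∈-map⁺; ∈-filter⁺; ∈-filter⁻; ∈-cartesianProductWith⁺)
open import Data.List.Relation.Unary.Any using (Any; here; there)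
import Data.List.Relation.Unary.Any as Any
open import Data.List.Relation.Unary.Any.Properties using (++⁺ˡ; ++⁺ʳ; ++⁻; map⁻)
open import Data.List.Relation.Unary.All using (All; []; _∷_; tabulate; lookup)
import Data.List.Relation.Unary.All as All
import Data.List.Relation.Unary.All.Properties as All
open import Data.Product using (Σ; _×_; _,_; proj₁; proj₂; map₁)
open import Data.Sum using (_⊎_; inj₁; inj₂; fromInj₂)
open import Data.Empty using (⊥; ⊥-elim)
import Data.Unit.Polymorphic as UP
open import Relation.Nullary using (¬_; Dec)
open import Relation.Nullary.Decidable using (fromSum)
open import Relation.Binary.PropositionalEquality using (_≡_; refl; cong)

choices : {A : Set} → List (List A) → List (List A)
choices []         = [ [] ]
choices (xs ∷ xss) = cartesianProductWith _∷_ xs (choices xss)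

map∈choices : {A : Set} (xss : List (List A)) (f : List A → A)
            → (∀ {xs} → xs ∈ xss → f xs ∈ xs) → map f xss ∈ choices xss
map∈choices []         f f∈ = here refl
map∈choices (xs ∷ xss) f f∈ =
  ∈-cartesianProductWith⁺ _∷_ (f∈ (here refl)) (map∈choices xss f (f∈ ∘ there))

module Classical (em : ExcludedMiddle) where

  dec : ∀ {ℓ} (P : Set ℓ) → Dec P
  dec P = fromSum (em P)

  choose : {A : Set} → A → (A → Set) → A
  choose {A} a P with em (Σ A P)
  ... | inj₁ (x , _) = x
  ... | inj₂ _       = a

  choose-spec : {A : Set} (a : A) (P : A → Set) → Σ A P → P (choose a P)
  choose-spec {A} a P w with em (Σ A P)
  ... | inj₁ (_ , p) = p
  ... | inj₂ ¬w      = ⊥-elim (¬w w)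

  module Canonical {A : Set} (_≈_ : A → A → Set)
                   (≈-sym : ∀ {x y} → x ≈ y → y ≈ x)
                   (≈-trans : ∀ {x y z} → x ≈ y → y ≈ z → x ≈ z) where

    canon : List A → A → A
    canon []       x = x
    canon (y ∷ ys) x with em (x ≈ y)
    ... | inj₁ _ = y
    ... | inj₂ _ = canon ys x

    canon-∈ : ∀ ys {x} → Any (x ≈_) ys → canon ys x ∈ ys × x ≈ canon ys x
    canon-∈ (y ∷ ys) {x} x∈ys with em (x ≈ y) | x∈ys
    ... | inj₁ x≈y | _           = here refl , x≈y
    ... | inj₂ x≉y | here x≈y    = ⊥-elim (x≉y x≈y)
    ... | inj₂ _   | there x∈ys′ = map₁ there (canon-∈ ys x∈ys′)

    canon-cong : ∀ ys {x x′} → x ≈ x′ → Any (x ≈_) ys → canon ys x ≡ canon ys x′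
    canon-cong (y ∷ ys) {x} {x′} x≈x′ x∈ys with em (x ≈ y) | em (x′ ≈ y) | x∈ys
    ... | inj₁ _   | inj₁ _    | _           = refl
    ... | inj₁ x≈y | inj₂ x′≉y | _           = ⊥-elim (x′≉y (≈-trans (≈-sym x≈x′) x≈y))
    ... | inj₂ x≉y | inj₁ x′≈y | _           = ⊥-elim (x≉y (≈-trans x≈x′ x′≈y))
    ... | inj₂ x≉y | inj₂ _    | here x≈y    = ⊥-elim (x≉y x≈y)
    ... | inj₂ _   | inj₂ _    | there x∈ys′ = canon-cong ys x≈x′ x∈ys′

module Theory (T : Set) (cl : Subset T → Subset T) (isClosure : IsClosure cl)
              (T₋ : Subset T) (T₊∩T₋≡∅ : ∀ t → cl (λ _ → ⊥) t → T₋ t → ⊥) where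
  open Setup T cl T₋
  open IsClosure isClosure

  ListEq-refl : ∀ A → ListEq A A
  ListEq-refl A t = id , id

  ListEq-sym : ∀ {A B} → ListEq A B → ListEq B A
  ListEq-sym A≈B t = proj₂ (A≈B t) , proj₁ (A≈B t)

  ListEq-trans : ∀ {A B C} → ListEq A B → ListEq B C → ListEq A C
  ListEq-trans A≈B B≈C t = proj₁ (B≈C t) ∘ proj₁ (A≈B t) , proj₂ (A≈B t) ∘ proj₂ (B≈C t)

  ∈⇒∈𝒱 : ∀ {A V} → A ∈ V → A ∈𝒱 V
  ∈⇒∈𝒱 = Any.map λ { refl → ListEq-refl _ }

  cl-coherent : ∀ X → (∀ t → cl X t → T₋ t → ⊥) → Coherent (cl X)
  cl-coherent X clX∩T₋≡∅ = idempotent X , clX∩T₋≡∅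

  cl-least : ∀ {X D} → Coherent D → X ⊆ D → cl X ⊆ D
  cl-least {X} {D} D-coh X⊆D t t∈clX = proj₁ (proj₁ D-coh) t (monotone X D X⊆D t t∈clX)

  T₊-coherent : Coherent T₊
  T₊-coherent = cl-coherent _ T₊∩T₋≡∅

  T₊⊆coherent : ∀ {D} → Coherent D → T₊ ⊆ D
  T₊⊆coherent D-coh = cl-least D-coh λ _ ()

  ≐E-refl : ∀ {X} → X ≐E X
  ≐E-refl D = id , id

  ≐E-sym : ∀ {X Y} → X ≐E Y → Y ≐E X
  ≐E-sym X≐Y D = proj₂ (X≐Y D) , proj₁ (X≐Y D)

  ≐E-trans : ∀ {X Y Z} → X ≐E Y → Y ≐E Z → X ≐E Z
  ≐E-trans X≐Y Y≐Z D = proj₁ (Y≐Z D) ∘ proj₁ (X≐Y D) , proj₂ (X≐Y D) ∘ proj₂ (Y≐Z D)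

  ∩E-cong : ∀ {X X′ Y Y′} → X ≐E X′ → Y ≐E Y′ → (X ∩E Y) ≐E (X′ ∩E Y′)
  ∩E-cong X≐X′ Y≐Y′ D = (λ (x , y) → proj₁ (X≐X′ D) x , proj₁ (Y≐Y′ D) y)
                      , (λ (x , y) → proj₂ (X≐X′ D) x , proj₂ (Y≐Y′ D) y)

  E-[] : E [] ≐E Dbar
  E-[] D = proj₁ , (λ D-coh → D-coh , [])

  E-singleton : ∀ A → E [ A ] ≐E DS A
  E-singleton A D = (λ { (_ , D∈DSA ∷ []) → D∈DSA }) , (λ D∈DSA → proj₁ D∈DSA , D∈DSA ∷ [])

  E-++ : ∀ V W → E (V ++ W) ≐E (E V ∩E E W)
  E-++ V W D = (λ (D-coh , VW) → (D-coh , All.++⁻ˡ V VW) , (D-coh , All.++⁻ʳ V VW))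
             , (λ ((D-coh , DV) , (_ , DW)) → D-coh , All.++⁺ DV DW)

  E⊆DS : ∀ {A V} → A ∈ V → E V ⊆E DS A
  E⊆DS A∈V D (_ , DV) = lookup DV A∈V

  DS-mono : ∀ {A B} → (∀ t → t ∈ A → t ∈ B) → DS A ⊆E DS B
  DS-mono A⊆B D (D-coh , D∩A) =
    let t , t∈A , t∈D = find D∩A in D-coh , lose (A⊆B t t∈A) t∈D

  DS-without-T₋ : ∀ {A B} → (∀ t → (t ∈ B → (t ∈ A × ¬ T₋ t)) × ((t ∈ A × ¬ T₋ t) → t ∈ B))
                → DS A ≐E DS B
  DS-without-T₋ B≡A∖T₋ D =
      (λ (D-coh , D∩A) → let t , t∈A , t∈D = find D∩A
                         in D-coh , lose (proj₂ (B≡A∖T₋ t) (t∈A , proj₂ D-coh t t∈D)) t∈D)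
    , DS-mono (λ t → proj₁ ∘ proj₁ (B≡A∖T₋ t)) D

  DS-T₊ : ∀ A → Any T₊ A → DS A ≐E Dbar
  DS-T₊ A A∩T₊ D = proj₁ , λ D-coh →
    let t , t∈A , t∈T₊ = find A∩T₊ in D-coh , lose t∈A (T₊⊆coherent D-coh t t∈T₊)

  DS-++ : ∀ A₁ A₂ → DS (A₁ ++ A₂) ≐E (E [ A₁ ] ∪E E [ A₂ ])
  DS-++ A₁ A₂ D = (λ (D-coh , D∩A) → split D-coh (++⁻ A₁ D∩A))
                , λ { (inj₁ (D-coh , (_ , D∩A₁) ∷ [])) → D-coh , ++⁺ˡ D∩A₁
                    ; (inj₂ (D-coh , (_ , D∩A₂) ∷ [])) → D-coh , ++⁺ʳ A₁ D∩A₂ }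
    where
    split : Coherent D → Any D A₁ ⊎ Any D A₂ → (E [ A₁ ] ∪E E [ A₂ ]) D
    split D-coh (inj₁ D∩A₁) = inj₁ (D-coh , (D-coh , D∩A₁) ∷ [])
    split D-coh (inj₂ D∩A₂) = inj₂ (D-coh , (D-coh , D∩A₂) ∷ [])

  E-T₊ : ∀ V → All MeetsT₊ V → E V ≐E Dbar
  E-T₊ V V∩T₊ D = proj₁ , λ D-coh →
    D-coh , tabulate λ {A} A∈V → proj₂ (DS-T₊ A (lower (lookup V∩T₊ A∈V)) D) D-coh

  DS⊆E∪E : ∀ {A B a b} → A ∈ a → B ∈ b → (E a ∪E E b) ⊆E DS (A ++ B)
  DS⊆E∪E A∈a B∈b D (inj₁ (D-coh , Da)) = D-coh , ++⁺ˡ (proj₂ (lookup Da A∈a))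
  DS⊆E∪E {A} A∈a B∈b D (inj₂ (D-coh , Db)) = D-coh , ++⁺ʳ A (proj₂ (lookup Db B∈b))

  EntailmentClosed : SDFS → Set₁
  EntailmentClosed F = ∀ V B → All F V → E V ⊆E DS B → F B

  Φ-intro : ∀ {F V} → All F V → Φ F V
  Φ-intro FV = _ , FV , ≐E-refl

  Φ-filter : ∀ F → EntailmentClosed F → Filter (Φ F)
  Φ-filter F closed = record
    { nonempty = [] , Φ-intro []
    ; upward   = λ { a b (V , FV , V≐a) a⊆b → Φ-intro (tabulate λ B∈b →
                     closed V _ FV λ D → E⊆DS B∈b D ∘ a⊆b D ∘ proj₁ (V≐a D)) }
    ; meet     = λ { a b c (V , FV , V≐a) (W , FW , W≐b) c≐a∩b →
                     V ++ W , All.++⁺ FV FW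
                   , ≐E-trans (E-++ V W) (≐E-trans (∩E-cong V≐a W≐b) (≐E-sym c≐a∩b)) }
    }

  Φ-proper : ∀ F → EntailmentClosed F → ¬ F [] → ¬ (∀ a → Φ F a)
  Φ-proper F closed F∌[] Φ-total =
    let V , FV , V≐[[]] = Φ-total [ [] ]
    in F∌[] (closed V [] FV λ D → proj₁ (E-singleton [] D) ∘ proj₁ (V≐[[]] D))

  Δ∘Φ : ∀ F → EntailmentClosed F → Δ (Φ F) ≐Q F
  Δ∘Φ F closed A =
      (λ (W , (V , FV , V≐W) , W≐A) → closed V A FV λ D → proj₁ (W≐A D) ∘ proj₁ (V≐W D))
    , (λ FA → [ A ] , Φ-intro (FA ∷ []) , E-singleton A)

  Φ-mono : ∀ {F₁ F₂} → F₁ ⊆Q F₂ → Φ F₁ ⊆F Φ F₂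
  Φ-mono F₁⊆F₂ W (V , F₁V , V≐W) = V , All.map (F₁⊆F₂ _) F₁V , V≐W

  Δ-mono : ∀ {𝓕₁ 𝓕₂} → 𝓕₁ ⊆F 𝓕₂ → Δ 𝓕₁ ⊆Q Δ 𝓕₂
  Δ-mono 𝓕₁⊆𝓕₂ A (W , 𝓕₁W , W≐A) = W , 𝓕₁⊆𝓕₂ W 𝓕₁W , W≐A

  Δ-intro : ∀ {𝓕 A} → 𝓕 [ A ] → Δ 𝓕 A
  Δ-intro {A = A} 𝓕A = [ A ] , 𝓕A , E-singleton A

  module FilterProperties {𝓕 : Family} (𝓕-filter : Filter 𝓕) where
    open Filter 𝓕-filter

    top : 𝓕 []
    top = let W , 𝓕W = nonempty in upward W [] 𝓕W λ D → (_, []) ∘ proj₁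

    All-Δ : ∀ V → All (Δ 𝓕) V → 𝓕 V
    All-Δ []      []                         = top
    All-Δ (A ∷ V) ((W , 𝓕W , W≐A) ∷ ΔV) =
      meet W V (A ∷ V) 𝓕W (All-Δ V ΔV) λ D →
          (λ { (D-coh , D∩A ∷ DV) → proj₂ (W≐A D) D∩A , (D-coh , DV) })
        , (λ (DW , D-coh , DV) → D-coh , proj₁ (W≐A D) DW ∷ DV)

    Δ-entailed : ∀ {V A} → 𝓕 V → E V ⊆E DS A → Δ 𝓕 A
    Δ-entailed {V} {A} 𝓕V V⊆A = Δ-intro (upward V [ A ] 𝓕V λ D → proj₂ (E-singleton A D) ∘ V⊆A D)

    Φ∘Δ : Φ (Δ 𝓕) ≐F 𝓕
    Φ∘Δ W = (λ (V , ΔV , V≐W) → upward V W (All-Δ V ΔV) (proj₁ ∘ V≐W))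
          , (λ 𝓕W → Φ-intro (tabulate λ A∈W → Δ-entailed 𝓕W (E⊆DS A∈W)))

  module Classically (em : ExcludedMiddle) (t₀ : T) where
    open Classical em
    open Canonical ListEq ListEq-sym ListEq-trans

    -- s reads off its value from the canonical representative, so it respects ListEq on V.
    choice-into : ∀ V {D : Subset T} → All (Any D) V
                → Σ (List T → T) λ s → Choice V s × Img V s ⊆ D
    choice-into V {D} D∩V = s , ((λ A A∈V → proj₁ (s-spec A A∈V)) , s-cong) , Img⊆D
      where
      s : List T → T
      s X = choose t₀ λ x → x ∈ canon V X × D x

      s-spec : ∀ X → X ∈𝒱 V → s X ∈ X × D (s X)
      s-spec X X∈V =
        let Y∈V , X≈Y = canon-∈ V X∈V
            x∈Y , x∈D = choose-spec t₀ _ (find (lookup D∩V Y∈V))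
        in proj₂ (X≈Y _) x∈Y , x∈D

      s-cong : ∀ A A′ → A ∈𝒱 V → ListEq A A′ → s A ≡ s A′
      s-cong A A′ A∈V A≈A′ = cong (λ Y → choose t₀ λ x → x ∈ Y × D x) (canon-cong V A≈A′ A∈V)

      Img⊆D : Img V s ⊆ D
      Img⊆D x x∈Img with find x∈Img
      ... | A , A∈V , refl = proj₂ (s-spec A (∈⇒∈𝒱 A∈V))

    enumerated-meets : ∀ V t B → ChoiceFamily V t → Enumerates V t B → E V ⊆E DS B
    enumerated-meets V t B (_ , t∈cl) enum D (D-coh , DV) =
      let s , s-choice , Img⊆D = choice-into V (All.map proj₂ DV)
      in D-coh , lose (proj₂ (enum (t s)) (s , s-choice , refl))
                      (cl-least D-coh Img⊆D (t s) (t∈cl s s-choice))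

    enumeration : ∀ V (g : List T → T) → Σ (List T) (Enumerates V λ s → g (map s V))
    enumeration V g =
        filter IsValue? (map g (choices V))
      , λ x → proj₂ ∘ ∈-filter⁻ IsValue? {xs = map g (choices V)}
            , λ { value@(s , s-choice , refl) → ∈-filter⁺ IsValue?
                    (∈-map⁺ g (map∈choices V s λ A∈V → proj₁ s-choice _ (∈⇒∈𝒱 A∈V))) value }
      where
      IsValue : T → Set
      IsValue x = Σ (List T → T) λ s → Choice V s × (x ≡ g (map s V))

      IsValue? : ∀ x → Dec (IsValue x)
      IsValue? x = dec (IsValue x)

    cl-meets : ∀ Y B → (∀ D → Coherent D → Y ⊆ D → Any D B)
             → Σ T λ x → cl Y x × (x ∈ B ⊎ T₋ x)
    cl-meets Y B B∩coherent with em (Σ T λ x → cl Y x × T₋ x)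
    ... | inj₁ (x , x∈clY , x∈T₋) = x , x∈clY , inj₂ x∈T₋
    ... | inj₂ clY∩T₋≢∅ =
      let x , x∈B , x∈clY = find (B∩coherent (cl Y) (cl-coherent Y λ x c m → clY∩T₋≢∅ (x , c , m))
                                             (extensive Y))
      in x , x∈clY , inj₁ x∈B

    finCoh-⊆∪T₋ : ∀ {F} → FinCoh F → ∀ B′ B → F B′ → (∀ x → x ∈ B′ → x ∈ B ⊎ T₋ x) → F B
    finCoh-⊆∪T₋ {F} F-fc B′ B FB′ B′⊆B∪T₋ = F2 B″ B FB″ B″⊆B
      where
      open FinCoh F-fc

      ∉T₋? : ∀ x → Dec (¬ T₋ x)
      ∉T₋? x = dec (¬ T₋ x)

      B″ : List T
      B″ = filter ∉T₋? (B′ ++ B)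

      FB″ : F B″
      FB″ = F3 (B′ ++ B) B″ (F2 B′ (B′ ++ B) FB′ λ _ → ++⁺ˡ)
               λ x → ∈-filter⁻ ∉T₋? {xs = B′ ++ B}
                   , λ (x∈B′++B , x∉T₋) → ∈-filter⁺ ∉T₋? x∈B′++B x∉T₋

      B″⊆B : ∀ x → x ∈ B″ → x ∈ B
      B″⊆B x x∈B″ with ∈-filter⁻ ∉T₋? {xs = B′ ++ B} x∈B″
      ... | x∈B′++B , x∉T₋ with ++⁻ B′ x∈B′++B
      ...   | inj₂ x∈B  = x∈B
      ...   | inj₁ x∈B′ with B′⊆B∪T₋ x x∈B′
      ...     | inj₁ x∈B  = x∈B
      ...     | inj₂ x∈T₋ = ⊥-elim (x∉T₋ x∈T₋)

    finCoh-entailmentClosed : ∀ {F} → FinCoh F → EntailmentClosed F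
    finCoh-entailmentClosed {F} F-fc [] B _ []⊆B =
      let t , t∈B , t∈T₊ = find (proj₂ ([]⊆B T₊ (T₊-coherent , [])))
      in F2 [ t ] B (F4 t t∈T₊) λ { _ (here refl) → t∈B }
      where open FinCoh F-fc
    finCoh-entailmentClosed {F} F-fc V@(_ ∷ _) B FV V⊆B =
      finCoh-⊆∪T₋ F-fc B′ B (F5 V (λ ()) FV t t-family B′ B′-enumerates) B′⊆B∪T₋
      where
      open FinCoh F-fc

      Witness : List T → T → Set
      Witness ys x = cl (_∈ ys) x × (x ∈ B ⊎ T₋ x)

      -- t factors through the tuple map s V so that it respects Agree without extensionality.
      g : List T → T
      g ys = choose t₀ (Witness ys)

      t : (List T → T) → T
      t s = g (map s V)

      t-witness : ∀ s → Choice V s → Witness (map s V) (t s)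
      t-witness s s-choice = choose-spec t₀ _ (cl-meets (_∈ map s V) B λ D D-coh sV⊆D →
        proj₂ (V⊆B D (D-coh , tabulate λ {A} A∈V →
          D-coh , lose (proj₁ s-choice A (∈⇒∈𝒱 A∈V)) (sV⊆D _ (∈-map⁺ s A∈V)))))

      t-family : ChoiceFamily V t
      t-family = (λ s s′ _ _ s≗s′ →
                    cong g (map-cong-local (tabulate λ A∈V → s≗s′ _ (∈⇒∈𝒱 A∈V))))
               , (λ s s-choice → monotone _ _ (λ _ → map⁻) (t s) (proj₁ (t-witness s s-choice)))

      B′ : List T
      B′ = proj₁ (enumeration V g)

      B′-enumerates : Enumerates V t B′
      B′-enumerates = proj₂ (enumeration V g)

      B′⊆B∪T₋ : ∀ x → x ∈ B′ → x ∈ B ⊎ T₋ x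
      B′⊆B∪T₋ x x∈B′ with proj₁ (B′-enumerates x) x∈B′
      ... | s , s-choice , refl = proj₂ (t-witness s s-choice)

    Φ-properFilter : ∀ {F} → FinCoh F → ProperFilter (Φ F)
    Φ-properFilter {F} F-fc =
      Φ-filter F closed , Φ-proper F closed (FinCoh.F1 F-fc)
      where
      closed : EntailmentClosed F
      closed = finCoh-entailmentClosed F-fc

    Δ-finCoh : ∀ {𝓕} → ProperFilter 𝓕 → FinCoh (Δ 𝓕)
    Δ-finCoh {𝓕} (𝓕-filter , 𝓕-proper) = record
      { F1 = λ (W , 𝓕W , W≐[]) → 𝓕-proper λ a →
               upward W a 𝓕W λ D → ⊥-elim ∘ DS[]-empty ∘ proj₁ (W≐[] D)
      ; F2 = λ A₁ A₂ (W , 𝓕W , W≐A₁) A₁⊆A₂ → Δ-entailed 𝓕W λ D → DS-mono A₁⊆A₂ D ∘ proj₁ (W≐A₁ D)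
      ; F3 = λ A B (W , 𝓕W , W≐A) B≡A∖T₋ → W , 𝓕W , ≐E-trans W≐A (DS-without-T₋ B≡A∖T₋)
      ; F4 = λ t t∈T₊ → [] , top , ≐E-trans E-[] (≐E-sym (DS-T₊ [ t ] (here t∈T₊)))
      ; F5 = λ V _ ΔV t t-family B enum →
               Δ-entailed (All-Δ V ΔV) (enumerated-meets V t B t-family enum)
      }
      where
      open Filter 𝓕-filter
      open FilterProperties 𝓕-filter
      DS[]-empty : ∀ {D} → ¬ DS [] D
      DS[]-empty (_ , ())

    inFfin-entailmentClosed : ∀ {F} → InFfin F → EntailmentClosed F
    inFfin-entailmentClosed (inj₁ F-fc)    = finCoh-entailmentClosed F-fc
    inFfin-entailmentClosed (inj₂ F-total) _ B _ _ = F-total B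

    Δ-inFfin : ∀ {𝓕} → Filter 𝓕 → InFfin (Δ 𝓕)
    Δ-inFfin {𝓕} 𝓕-filter with em (∀ a → 𝓕 a)
    ... | inj₁ 𝓕-total  = inj₂ λ A → Δ-intro (𝓕-total [ A ])
    ... | inj₂ 𝓕-proper = inj₁ (Δ-finCoh (𝓕-filter , 𝓕-proper))

    complete-splits : ∀ {F} → EntailmentClosed F → Complete F
                    → ∀ V a b → All F V → E V ⊆E (E a ∪E E b) → All F a ⊎ All F b
    complete-splits {F} closed complete V a b FV V⊆a∪b with em (All F a)
    ... | inj₁ Fa = inj₁ Fa
    ... | inj₂ ¬Fa =
      let A , A∈a , A∉F = find (All.¬All⇒Any¬ (λ A → dec (F A)) a ¬Fa)
      in inj₂ (tabulate λ B∈b →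
           fromInj₂ (⊥-elim ∘ A∉F) (complete A _ (closed V _ FV λ D → DS⊆E∪E A∈a B∈b D ∘ V⊆a∪b D)))

    complete⇒prime : ∀ {𝓕 F} → EntailmentClosed F → ProperFilter 𝓕 → 𝓕 ≐F Φ F
                   → Complete F → PrimeFilter 𝓕
    complete⇒prime {𝓕} {F} closed 𝓕-proper 𝓕≐ΦF complete = 𝓕-proper , prime
      where
      prime : ∀ a b c → E c ≐E (E a ∪E E b) → 𝓕 c → 𝓕 a ⊎ 𝓕 b
      prime a b c c≐a∪b 𝓕c with proj₁ (𝓕≐ΦF c) 𝓕c
      ... | V , FV , V≐c
          with complete-splits closed complete V a b FV (λ D → proj₁ (c≐a∪b D) ∘ proj₁ (V≐c D))
      ...   | inj₁ Fa = inj₁ (proj₂ (𝓕≐ΦF a) (Φ-intro Fa))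
      ...   | inj₂ Fb = inj₂ (proj₂ (𝓕≐ΦF b) (Φ-intro Fb))

  prime⇒complete : ∀ {𝓕 F} → PrimeFilter 𝓕 → F ≐Q Δ 𝓕 → Complete F
  prime⇒complete {𝓕} (_ , prime) F≐Δ𝓕 A₁ A₂ FA₁A₂ with proj₁ (F≐Δ𝓕 (A₁ ++ A₂)) FA₁A₂
  ... | W , 𝓕W , W≐A₁A₂ with prime [ A₁ ] [ A₂ ] W (≐E-trans W≐A₁A₂ (DS-++ A₁ A₂)) 𝓕W
  ...   | inj₁ 𝓕A₁ = inj₁ (proj₂ (F≐Δ𝓕 A₁) (Δ-intro 𝓕A₁))
  ...   | inj₂ 𝓕A₂ = inj₂ (proj₂ (F≐Δ𝓕 A₂) (Δ-intro 𝓕A₂))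

  Φ-MeetsT₊ : Φ MeetsT₊ ≐F SingletonDbar
  Φ-MeetsT₊ W = (λ (V , V∩T₊ , V≐W) → ≐E-trans (≐E-sym V≐W) (E-T₊ V V∩T₊))
              , (λ W≐Dbar → [] , [] , ≐E-trans E-[] (≐E-sym W≐Dbar))

  Φ-AllQ : Φ AllQ ≐F AllE
  Φ-AllQ W = (λ _ → UP.tt) , (λ _ → Φ-intro (tabulate λ _ → UP.tt))

  Δ-SingletonDbar : Δ SingletonDbar ≐Q MeetsT₊
  Δ-SingletonDbar A =
      (λ (W , W≐Dbar , W≐A) → lift (proj₂ (proj₂ (≐E-trans (≐E-sym W≐A) W≐Dbar T₊) T₊-coherent)))
    , (λ A∩T₊ → Δ-intro (≐E-trans (E-singleton A) (DS-T₊ A (lower A∩T₊))))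

  Δ-AllE : Δ AllE ≐Q AllQ
  Δ-AllE A = (λ _ → UP.tt) , (λ _ → Δ-intro UP.tt)

theorem11 : ExcludedMiddle → (T : Set) → T → (cl : Subset T → Subset T) → IsClosure cl
    → (T₋ : Subset T) → (∀ t → cl (λ _ → ⊥) t → T₋ t → ⊥)
    → let open Setup T cl T₋ in
      -- (i)
      (∀ F → RespQ F → FinCoh F → ProperFilter (Φ F))
      -- (ii)
    × (∀ 𝓕 → RespE 𝓕 → ProperFilter 𝓕 → FinCoh (Δ 𝓕))
      -- (iii)
    × (∀ F → RespQ F → FinCoh F → Δ (Φ F) ≐Q F)
      -- (iv)
    × (∀ 𝓕 → RespE 𝓕 → ProperFilter 𝓕 → Φ (Δ 𝓕) ≐F 𝓕)
      -- (v)
    × (∀ F₁ F₂ → RespQ F₁ → RespQ F₂ → F₁ ⊆Q F₂ → Φ F₁ ⊆F Φ F₂)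
      -- (vi)
    × (∀ 𝓕₁ 𝓕₂ → RespE 𝓕₁ → RespE 𝓕₂ → 𝓕₁ ⊆F 𝓕₂ → Δ 𝓕₁ ⊆Q Δ 𝓕₂)
      -- (vii)
    × ((Φ MeetsT₊ ≐F SingletonDbar) × (Φ AllQ ≐F AllE))
      -- (viii)
    × ((Δ SingletonDbar ≐Q MeetsT₊) × (Δ AllE ≐Q AllQ))
      -- order isomorphism between 𝐅_fin and all filters on Ê_fin
    × ((∀ F → RespQ F → InFfin F → Filter (Φ F))
      × (∀ 𝓕 → RespE 𝓕 → Filter 𝓕 → InFfin (Δ 𝓕))
      × (∀ F → RespQ F → InFfin F → Δ (Φ F) ≐Q F)
      × (∀ 𝓕 → RespE 𝓕 → Filter 𝓕 → Φ (Δ 𝓕) ≐F 𝓕))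
      -- (ix)
    × (∀ 𝓕 F → RespE 𝓕 → RespQ F → ProperFilter 𝓕 → FinCoh F
         → 𝓕 ≐F Φ F → F ≐Q Δ 𝓕
         → (PrimeFilter 𝓕 → Complete F) × (Complete F → PrimeFilter 𝓕))
-- Every construction acts on the denoted sets E V.
theorem11 em T t₀ cl isClosure T₋ T₊∩T₋≡∅ =
    (λ F _ → Φ-properFilter)
  , (λ 𝓕 _ → Δ-finCoh)
  , (λ F _ → Δ∘Φ F ∘ finCoh-entailmentClosed)
  , (λ 𝓕 _ (𝓕-filter , _) → FilterProperties.Φ∘Δ 𝓕-filter)
  , (λ F₁ F₂ _ _ → Φ-mono)
  , (λ 𝓕₁ 𝓕₂ _ _ → Δ-mono)
  , (Φ-MeetsT₊ , Φ-AllQ)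
  , (Δ-SingletonDbar , Δ-AllE)
  , ( (λ F _ → Φ-filter F ∘ inFfin-entailmentClosed)
    , (λ 𝓕 _ → Δ-inFfin)
    , (λ F _ → Δ∘Φ F ∘ inFfin-entailmentClosed)
    , (λ 𝓕 _ → FilterProperties.Φ∘Δ))
  , λ 𝓕 F _ _ 𝓕-proper F-fc 𝓕≐ΦF F≐Δ𝓕 →
      (λ 𝓕-prime → prime⇒complete 𝓕-prime F≐Δ𝓕)
    , complete⇒prime (finCoh-entailmentClosed F-fc) 𝓕-proper 𝓕≐ΦF
  where
  open Theory T cl isClosure T₋ T₊∩T₋≡∅
  open Classically em t₀
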